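{- Let $G=\langle a,b\mid a^m=b^n=1,\ b^{ -1}ab=a^r\rangle$ be a group of odd order all of whose Sylow subgroups are cyclic, where $r\not\equiv 1\pmod m$ and $r^n\equiv 1\pmod m$, and suppose $G$ is not a direct product of any two non-trivial subgroups. Let $\sigma$ be an automorphism of $G$ of order $2$. Then there are integers $i,s$ such that $\sigma(b)=a^ib$ with $o(a^ib)=n$, and $\sigma(a)=a^s$ with $s^2\equiv 1\pmod m$.
   Context: $o(g)$ denotes the order of an element $g$. Here $a$ has order $m$ and $b$ has order $n$. -}

module Defs where

open import Data.Nat using (ℕ; zero; suc; _+_; _*_; _^_; _≤_; _<_; NonZero)
open import Data.Nat.DivMod using (_mod_)
open import Data.Fin using (Fin; toℕ)
open import Data.Product using (Σ; _×_; _,_)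
open import Data.List using (List; length; filterᵇ; cartesianProduct; allFin)
open import Data.Bool using (Bool; true)
open import Data.Nat.Divisibility using (_∣_)
open import Data.Nat.Primality using (Prime)
open import Relation.Binary.PropositionalEquality using (_≡_; _≢_)
open import Relation.Nullary using (¬_)

-- The group G = ⟨ a , b ∣ a^m = b^n = 1 , b⁻¹ a b = a^r ⟩ (with r^n ≡ 1 mod m),
-- realised concretely in normal form: the pair (j , i) stands for b^j a^i.
-- From a b = b a^r one gets a^i b^l = b^l a^(i r^l), hence
--   (b^j a^i)(b^l a^k) = b^(j+l) a^(i r^l + k).
module Metacyclic (m n r : ℕ) .{{_ : NonZero m}} .{{_ : NonZero n}} where

  G : Set
  G = Fin n × Fin m

  e : G
  e = (0 mod n , 0 mod m)

  infixl 7 _·_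
  _·_ : G → G → G
  (j , i) · (l , k) = ((toℕ j + toℕ l) mod n , (toℕ i * r ^ toℕ l + toℕ k) mod m)

  a : G
  a = (0 mod n , 1 mod m)

  b : G
  b = (1 mod n , 0 mod m)

  infixr 8 _^ᴳ_
  _^ᴳ_ : G → ℕ → G
  g ^ᴳ zero = e
  g ^ᴳ suc k = g · (g ^ᴳ k)

  HasOrder : G → ℕ → Set
  HasOrder g k = 1 ≤ k × g ^ᴳ k ≡ e × (∀ j → 1 ≤ j → j < k → g ^ᴳ j ≢ e)

  elements : List G
  elements = cartesianProduct (allFin n) (allFin m)

  ∣G∣ : ℕ
  ∣G∣ = length elements

  -- subsets of the finite set G (decidable, as all subsets of a finite set are)
  Subset : Set
  Subset = G → Bool

  _∈_ : G → Subset → Set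
  x ∈ H = H x ≡ true

  ∣_∣ : Subset → ℕ
  ∣ H ∣ = length (filterᵇ H elements)

  IsSubgroup : Subset → Set
  IsSubgroup H = e ∈ H × (∀ x y → x ∈ H → y ∈ H → (x · y) ∈ H)
                 × (∀ x → x ∈ H → Σ G λ y → y ∈ H × x · y ≡ e)

  IsNormal : Subset → Set
  IsNormal H = IsSubgroup H
               × (∀ g g' h → g · g' ≡ e → h ∈ H → (g · h · g') ∈ H)

  IsCyclic : Subset → Set
  IsCyclic H = Σ G λ g → g ∈ H × (∀ h → h ∈ H → Σ ℕ λ k → h ≡ g ^ᴳ k)

  IsSylow : ℕ → Subset → Set
  IsSylow p H = IsSubgroup H × Σ ℕ λ k → ∣ H ∣ ≡ p ^ k × (p ^ k) ∣ ∣G∣ × ¬ ((p ^ suc k) ∣ ∣G∣)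

  AllSylowCyclic : Set
  AllSylowCyclic = ∀ p H → Prime p → IsSylow p H → IsCyclic H

  Nontrivial : Subset → Set
  Nontrivial H = Σ G λ x → x ∈ H × x ≢ e

  IsDirectProduct : Subset → Subset → Set
  IsDirectProduct H K = IsNormal H × IsNormal K
                        × (∀ x → x ∈ H → x ∈ K → x ≡ e)
                        × (∀ g → Σ G λ h → Σ G λ k → h ∈ H × k ∈ K × g ≡ h · k)

  Indecomposable : Set
  Indecomposable = ¬ (Σ Subset λ H → Σ Subset λ K →
                        Nontrivial H × Nontrivial K × IsDirectProduct H K)

  IsAutomorphism : (G → G) → Set
  IsAutomorphism σ = (∀ x y → σ (x · y) ≡ σ x · σ y)
                     × Σ (G → G) λ τ → (∀ x → τ (σ x) ≡ x) × (∀ x → σ (τ x) ≡ x)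

  HasOrder2 : (G → G) → Set
  HasOrder2 σ = (∀ x → σ (σ x) ≡ x) × ¬ (∀ x → σ x ≡ x)

{-# OPTIONS --safe #-}
-- Writing elements as b^j a^i turns identities in G into congruences: modulo n for the exponent of b
-- and modulo m for that of a.  If a prime p divided both n and m, the elements whose exponents are
-- divisible by the p′-parts n′ of n and m′ of m would form a Sylow p-subgroup containing a^(m/p) and
-- b^n′, which are not powers of a common element; so n and m are coprime.  As σ a has order m, its
-- b-exponent is then 0, i.e. σ a = a^s, and σ² = 1 gives s² ≡ 1 (mod m).  Writing σ b = b^t a^c,
-- applying σ to a b = b a^r gives r^t ≡ r (mod m), and σ² = 1 gives t² ≡ 1 (mod n).  If t ≠ 1, then
-- d₁ = gcd(t − 1, n) and d₂ = n / d₁ are coprime because n is odd, r^d₁ ≡ 1 (mod m), and G is the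
-- direct product of the central subgroup ⟨b^d₁⟩ and ⟨b^d₂, a⟩, contradicting indecomposability.
-- Hence σ b = b a^c = a^(c r^(n-1)) b, and it has order n because b does.
module Submission where

open import Defs
open import Data.Nat
open import Data.Nat.Properties
open import Data.Nat.DivMod hiding (_mod_)
open import Data.Nat.Divisibility
open import Data.Nat.GCD using (gcd; gcd-GCD; module Bézout; gcd[m,n]∣m; gcd[m,n]∣n; gcd[m,n]≢0; gcd[m,n]≡0⇒m≡0)
open import Data.Nat.Coprimality using (Coprime; coprime?; gcd≡1⇒coprime; coprime-divisor; coprime-Bézout; coprime-/gcd)
import Data.Nat.Coprimality as Coprimality
open import Data.Nat.Primality using (Prime; ¬prime[1]; prime⇒irreducible; prime[2]; prime⇒nonZero; prime⇒nonTrivial; euclidsLemma)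
open import Data.Nat.Primality.Factorisation using (factorise)
open import Data.Nat.ListAction using (product)
open import Data.Nat.Induction using (<-rec)
open import Data.Nat.Tactic.RingSolver using (solve-∀)
open import Data.Bool using (Bool; true; false; T; T?; _∧_)
open import Data.Fin using (Fin; toℕ; fromℕ<)
open import Data.Fin.Properties using (toℕ-fromℕ<; fromℕ<-cong; toℕ-injective; toℕ<n)
open import Data.List using (List; []; _∷_; _++_; map; length; filterᵇ; cartesianProduct; allFin; upTo; applyUpTo; tabulate)
open import Data.List.Properties using (filter-++; length-++; length-map; length-tabulate; filter-none; map-tabulate; map-upTo)
open import Data.List.Relation.Unary.All using (_∷_; universal)
open import Data.List.Relation.Unary.All.Properties using (applyUpTo⁺₁)
open import Data.Product using (Σ; _×_; _,_; proj₁; proj₂)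
open import Data.Sum using (inj₁; inj₂)
open import Data.Empty using (⊥; ⊥-elim)
open import Function using (_∘_; id)
open import Relation.Binary.PropositionalEquality
open import Relation.Nullary using (¬_; yes; no; contradiction)
open import Relation.Nullary.Decidable using (isYes; toWitness)

-- Congruences

infix 4 _≡_mod_
_≡_mod_ : ℕ → ℕ → (d : ℕ) → .{{NonZero d}} → Set
_≡_mod_ x y d = x % d ≡ y % d

module _ {d : ℕ} .{{_ : NonZero d}} where

  %-≡-mod : ∀ x → x % d ≡ x mod d
  %-≡-mod x = m%n%n≡m%n x d

  +-cong-mod : ∀ {x x′ y y′} → x ≡ x′ mod d → y ≡ y′ mod d → x + y ≡ x′ + y′ mod d
  +-cong-mod {x} {x′} {y} {y′} x≡x′ y≡y′ = begin
    (x + y) % d              ≡⟨ %-distribˡ-+ x y d ⟩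
    (x % d + y % d) % d      ≡⟨ cong₂ (λ u v → (u + v) % d) x≡x′ y≡y′ ⟩
    (x′ % d + y′ % d) % d    ≡⟨ %-distribˡ-+ x′ y′ d ⟨
    (x′ + y′) % d            ∎
    where open ≡-Reasoning

  *-cong-mod : ∀ {x x′ y y′} → x ≡ x′ mod d → y ≡ y′ mod d → x * y ≡ x′ * y′ mod d
  *-cong-mod {x} {x′} {y} {y′} x≡x′ y≡y′ = begin
    (x * y) % d              ≡⟨ %-distribˡ-* x y d ⟩
    (x % d * (y % d)) % d    ≡⟨ cong₂ (λ u v → (u * v) % d) x≡x′ y≡y′ ⟩
    (x′ % d * (y′ % d)) % d  ≡⟨ %-distribˡ-* x′ y′ d ⟨
    (x′ * y′) % d            ∎
    where open ≡-Reasoning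

  ^-cong-mod : ∀ {x y} → x ≡ y mod d → ∀ k → x ^ k ≡ y ^ k mod d
  ^-cong-mod x≡y zero    = refl
  ^-cong-mod x≡y (suc k) = *-cong-mod x≡y (^-cong-mod x≡y k)

  ∣⇒≡0-mod : ∀ {x} → d ∣ x → x ≡ 0 mod d
  ∣⇒≡0-mod {x} d∣x = trans (n∣m⇒m%n≡0 x d d∣x) (sym (n∣m⇒m%n≡0 0 d (d ∣0)))

  ≡0-mod⇒∣ : ∀ {x} → x ≡ 0 mod d → d ∣ x
  ≡0-mod⇒∣ {x} x≡0 = m%n≡0⇒n∣m x d (trans x≡0 (n∣m⇒m%n≡0 0 d (d ∣0)))

  ≡-mod⇒≡ : ∀ {x y} → x < d → y < d → x ≡ y mod d → x ≡ y
  ≡-mod⇒≡ x<d y<d x≡y = trans (sym (m<n⇒m%n≡m x<d)) (trans x≡y (m<n⇒m%n≡m y<d))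

  -- Adding d ∸ z % d, an additive inverse of z modulo d, to both sides.
  +-cancelʳ-mod : ∀ {x y} z → x + z ≡ y + z mod d → x ≡ y mod d
  +-cancelʳ-mod {x} {y} z x+z≡y+z = begin
    x % d                ≡⟨ %-remove-+ʳ x d∣z+z′ ⟨
    (x + (z + z′)) % d   ≡⟨ cong (_% d) (+-assoc x z z′) ⟨
    (x + z + z′) % d     ≡⟨ +-cong-mod {x + z} {y + z} {z′} x+z≡y+z refl ⟩
    (y + z + z′) % d     ≡⟨ cong (_% d) (+-assoc y z z′) ⟩
    (y + (z + z′)) % d   ≡⟨ %-remove-+ʳ y d∣z+z′ ⟩
    y % d                ∎
    where
    open ≡-Reasoning
    z′ = d ∸ z % d
    d∣z+z′ : d ∣ z + z′
    d∣z+z′ = ≡0-mod⇒∣ (begin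
      (z + z′) % d         ≡⟨ +-cong-mod {z} {z % d} {z′} (sym (%-≡-mod z)) refl ⟩
      (z % d + z′) % d     ≡⟨ cong (_% d) (m+[n∸m]≡n (m%n≤n z d)) ⟩
      d % d                ≡⟨ ∣⇒≡0-mod ∣-refl ⟩
      0 % d                ∎)

  *-cancelˡ-mod : ∀ {s x y} → s * s ≡ 1 mod d → s * x ≡ s * y mod d → x ≡ y mod d
  *-cancelˡ-mod {s} {x} {y} s²≡1 sx≡sy = begin
    x % d                ≡⟨ cong (_% d) (*-identityˡ x) ⟨
    (1 * x) % d          ≡⟨ *-cong-mod {1} {s * s} {x} (sym s²≡1) refl ⟩
    (s * s * x) % d      ≡⟨ cong (_% d) (*-assoc s s x) ⟩
    (s * (s * x)) % d    ≡⟨ *-cong-mod {s} refl sx≡sy ⟩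
    (s * (s * y)) % d    ≡⟨ cong (_% d) (*-assoc s s y) ⟨
    (s * s * y) % d      ≡⟨ *-cong-mod {s * s} {1} {y} s²≡1 refl ⟩
    (1 * y) % d          ≡⟨ cong (_% d) (*-identityˡ y) ⟩
    y % d                ∎
    where open ≡-Reasoning

  ^≡1⇒^*≡1 : ∀ {x k} q → x ^ k ≡ 1 mod d → x ^ (q * k) ≡ 1 mod d
  ^≡1⇒^*≡1 {x} {k} q xᵏ≡1 = begin
    x ^ (q * k) % d     ≡⟨ cong (λ e → x ^ e % d) (*-comm q k) ⟩
    x ^ (k * q) % d     ≡⟨ cong (_% d) (^-*-assoc x k q) ⟨
    (x ^ k) ^ q % d     ≡⟨ ^-cong-mod xᵏ≡1 q ⟩
    1 ^ q % d           ≡⟨ cong (_% d) (^-zeroˡ q) ⟩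
    1 % d               ∎
    where open ≡-Reasoning

  ^≡1⇒∣⇒^≡1 : ∀ {x k l} → x ^ k ≡ 1 mod d → k ∣ l → x ^ l ≡ 1 mod d
  ^≡1⇒∣⇒^≡1 xᵏ≡1 (divides q refl) = ^≡1⇒^*≡1 q xᵏ≡1

  ^+≡1⇒^≡1 : ∀ {x} k {l} → x ^ (k + l) ≡ 1 mod d → x ^ l ≡ 1 mod d → x ^ k ≡ 1 mod d
  ^+≡1⇒^≡1 {x} k {l} xᵏ⁺ˡ≡1 xˡ≡1 = begin
    x ^ k % d              ≡⟨ cong (_% d) (*-identityʳ (x ^ k)) ⟨
    (x ^ k * 1) % d        ≡⟨ *-cong-mod {x ^ k} refl (sym xˡ≡1) ⟩
    (x ^ k * x ^ l) % d    ≡⟨ cong (_% d) (^-distribˡ-+-* x k l) ⟨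
    x ^ (k + l) % d        ≡⟨ xᵏ⁺ˡ≡1 ⟩
    1 % d                  ∎
    where open ≡-Reasoning

  ^≡1⇒^gcd≡1 : ∀ {x u v} → x ^ u ≡ 1 mod d → x ^ v ≡ 1 mod d → x ^ gcd u v ≡ 1 mod d
  ^≡1⇒^gcd≡1 {x} {u} {v} xᵘ≡1 xᵛ≡1 with Bézout.identity (gcd-GCD u v)
  ... | Bézout.+- p q g+qv≡pu = ^+≡1⇒^≡1 (gcd u v)
          (subst (λ e → x ^ e ≡ 1 mod d) (sym g+qv≡pu) (^≡1⇒^*≡1 p xᵘ≡1)) (^≡1⇒^*≡1 q xᵛ≡1)
  ... | Bézout.-+ p q g+pu≡qv = ^+≡1⇒^≡1 (gcd u v)
          (subst (λ e → x ^ e ≡ 1 mod d) (sym g+pu≡qv) (^≡1⇒^*≡1 q xᵛ≡1)) (^≡1⇒^*≡1 p xᵘ≡1)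

  ^≡1⇒^%≡^ : ∀ {x n} .{{_ : NonZero n}} → x ^ n ≡ 1 mod d → ∀ k → x ^ (k % n) ≡ x ^ k mod d
  ^≡1⇒^%≡^ {x} {n} xⁿ≡1 k = begin
    x ^ (k % n) % d                       ≡⟨ cong (_% d) (*-identityʳ _) ⟨
    (x ^ (k % n) * 1) % d                 ≡⟨ *-cong-mod {x ^ (k % n)} refl (sym (^≡1⇒^*≡1 (k / n) xⁿ≡1)) ⟩
    (x ^ (k % n) * x ^ (k / n * n)) % d   ≡⟨ cong (_% d) (^-distribˡ-+-* x (k % n) _) ⟨
    x ^ (k % n + k / n * n) % d           ≡⟨ cong (λ e → x ^ e % d) (m≡m%n+[m/n]*n k n) ⟨
    x ^ k % d                             ∎
    where open ≡-Reasoning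

  -- x is a unit modulo d, with inverse x^(n-1).
  ^suc≡⇒^≡1 : ∀ {x n u} .{{_ : NonZero n}} → x ^ n ≡ 1 mod d → x ^ suc u ≡ x mod d → x ^ u ≡ 1 mod d
  ^suc≡⇒^≡1 {x} {n} {u} xⁿ≡1 x¹⁺ᵘ≡x = ^+≡1⇒^≡1 u xᵘ⁺ⁿ≡1 xⁿ≡1
    where
    open ≡-Reasoning
    xᵘ⁺ⁿ≡1 : x ^ (u + n) ≡ 1 mod d
    xᵘ⁺ⁿ≡1 = begin
      x ^ (u + n) % d                  ≡⟨ cong (λ k → x ^ k % d) (trans (cong (u +_) (sym (suc-pred n))) (+-suc u (pred n))) ⟩
      x ^ (suc u + pred n) % d         ≡⟨ cong (_% d) (^-distribˡ-+-* x (suc u) (pred n)) ⟩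
      (x ^ suc u * x ^ pred n) % d     ≡⟨ *-cong-mod x¹⁺ᵘ≡x refl ⟩
      (x * x ^ pred n) % d             ≡⟨ cong (λ k → x ^ k % d) (suc-pred n) ⟩
      x ^ n % d                        ≡⟨ xⁿ≡1 ⟩
      1 % d                            ∎

-- Divisibility and primes

∣-resp-≡-mod : ∀ {d N x y} .{{_ : NonZero N}} → d ∣ N → x ≡ y mod N → d ∣ y → d ∣ x
∣-resp-≡-mod d∣N x≡y d∣y = ∣n∣m%n⇒∣m d∣N (subst (_ ∣_) (sym x≡y) (%-presˡ-∣ d∣y d∣N))

split-prime-power : ∀ {p} → 1 < p → ∀ N → .{{NonZero N}} →
                    Σ ℕ λ α → Σ ℕ λ N′ → N ≡ p ^ α * N′ × ¬ p ∣ N′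
split-prime-power {p} 1<p = <-rec Split split
  where
  Split : ℕ → Set
  Split N = .{{NonZero N}} → Σ ℕ λ α → Σ ℕ λ N′ → N ≡ p ^ α * N′ × ¬ p ∣ N′
  split : ∀ N → (∀ {M} → M < N → Split M) → Split N
  split N rec with p ∣? N
  ... | no p∤N = 0 , N , sym (+-identityʳ N) , p∤N
  ... | yes (divides q refl) with rec (m<m*n q p {{m*n≢0⇒m≢0 q}} 1<p) {{m*n≢0⇒m≢0 q}}
  ...   | α , N′ , q≡pᵅN′ , p∤N′ = suc α , N′ , q*p≡p¹⁺ᵅN′ , p∤N′
    where
    q*p≡p¹⁺ᵅN′ : q * p ≡ p ^ suc α * N′
    q*p≡p¹⁺ᵅN′ = begin
      q * p                ≡⟨ cong (_* p) q≡pᵅN′ ⟩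
      p ^ α * N′ * p       ≡⟨ rearrange (p ^ α) N′ p ⟩
      p * p ^ α * N′       ∎
      where
      open ≡-Reasoning
      rearrange : ∀ x y z → x * y * z ≡ z * x * y
      rearrange = solve-∀

prime-divisor : ∀ {d} → 1 < d → Σ ℕ λ p → Prime p × p ∣ d
prime-divisor {d} 1<d with factorise d {{>-nonZero (<-trans z<s 1<d)}}
... | record { factors = [] ; isFactorisation = d≡1 } = contradiction d≡1 (>⇒≢ 1<d)
... | record { factors = p ∷ ps ; isFactorisation = d≡p*Πps ; factorsPrime = p-prime ∷ _ } =
      p , p-prime , divides (product ps) (trans d≡p*Πps (*-comm p (product ps)))

¬coprime⇒common-prime-divisor : ∀ {x y} → x ≢ 0 → ¬ Coprime x y → Σ ℕ λ p → Prime p × p ∣ x × p ∣ y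
¬coprime⇒common-prime-divisor {x} {y} x≢0 ¬x⊥y with gcd x y in g≡
... | 0 = contradiction (gcd[m,n]≡0⇒m≡0 g≡) x≢0
... | 1 = ⊥-elim (¬x⊥y (gcd≡1⇒coprime g≡))
... | suc (suc g) with prime-divisor {suc (suc g)} (s<s z<s)
...   | p , p-prime , p∣g = p , p-prime ,
        ∣-trans p∣g (subst (_∣ x) g≡ (gcd[m,n]∣m x y)) , ∣-trans p∣g (subst (_∣ y) g≡ (gcd[m,n]∣n x y))

prime-power-split : ∀ {p N} .{{_ : NonZero N}} → Prime p → p ∣ N →
                    Σ ℕ λ α → Σ ℕ λ N′ → N ≡ p ^ suc α * N′ × ¬ p ∣ N′
prime-power-split {p} {N} p-prime p∣N with split-prime-power (nonTrivial⇒n>1 p {{prime⇒nonTrivial p-prime}}) N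
... | zero  , N′ , N≡1*N′ , p∤N′ = ⊥-elim (p∤N′ (subst (p ∣_) (trans N≡1*N′ (*-identityˡ N′)) p∣N))
... | suc α , N′ , N≡pᵅN′ , p∤N′ = α , N′ , N≡pᵅN′ , p∤N′

nonZero-factorʳ : ∀ {N} x {y} .{{_ : NonZero N}} → N ≡ x * y → NonZero y
nonZero-factorʳ {N} x N≡xy = ≢-nonZero (λ y≡0 → ≢-nonZero⁻¹ N (trans N≡xy (trans (cong (x *_) y≡0) (*-zeroʳ x))))

coprime⇒*∣ : ∀ {d₁ d₂ k} → Coprime d₁ d₂ → d₁ ∣ k → d₂ ∣ k → d₁ * d₂ ∣ k
coprime⇒*∣ {d₁} {d₂} d₁⊥d₂ (divides q refl) d₂∣qd₁ with coprime-divisor (Coprimality.sym d₁⊥d₂) (subst (d₂ ∣_) (*-comm q d₁) d₂∣qd₁)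
... | divides q′ refl = divides q′ (trans (*-assoc q′ d₂ d₁) (cong (q′ *_) (*-comm d₂ d₁)))

-- From a Bézout identity 1 + y d₂ = x d₁, split j = j x d₁ - j y d₂, where −1 ≡ N − 1 modulo N.
split-by-Bézout : ∀ {d₁ d₂} x y → 1 + y * d₂ ≡ x * d₁ → ∀ N .{{_ : NonZero N}} j →
                  Σ ℕ λ j₁ → Σ ℕ λ j₂ → d₁ ∣ j₁ × d₂ ∣ j₂ × j₁ + j₂ ≡ j mod N
split-by-Bézout {d₁} {d₂} x y 1+yd₂≡xd₁ N j =
  j * (x * d₁) , j * (y * d₂) * pred N ,
  ∣n⇒∣m*n j (n∣m*n x) , ∣m⇒∣m*n (pred N) (∣n⇒∣m*n j (n∣m*n y)) , j₁+j₂≡j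
  where
  open ≡-Reasoning
  j₁+j₂≡j : j * (x * d₁) + j * (y * d₂) * pred N ≡ j mod N
  j₁+j₂≡j = begin
    (j * (x * d₁) + j * (y * d₂) * pred N) % N       ≡⟨ cong (λ z → (j * z + j * (y * d₂) * pred N) % N) 1+yd₂≡xd₁ ⟨
    (j * (1 + y * d₂) + j * (y * d₂) * pred N) % N   ≡⟨ cong (_% N) (regroup j (y * d₂) (pred N)) ⟩
    (j + j * (y * d₂) * suc (pred N)) % N            ≡⟨ cong (λ z → (j + j * (y * d₂) * z) % N) (suc-pred N) ⟩
    (j + j * (y * d₂) * N) % N                       ≡⟨ %-remove-+ʳ j (n∣m*n (j * (y * d₂))) ⟩
    j % N                                            ∎
    where
    regroup : ∀ j z p → j * (1 + z) + j * z * p ≡ j + j * z * (1 + p)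
    regroup = solve-∀

coprime⇒split : ∀ {d₁ d₂} → Coprime d₁ d₂ → ∀ N .{{_ : NonZero N}} j →
                Σ ℕ λ j₁ → Σ ℕ λ j₂ → d₁ ∣ j₁ × d₂ ∣ j₂ × j₁ + j₂ ≡ j mod N
coprime⇒split d₁⊥d₂ N j with coprime-Bézout d₁⊥d₂
... | Bézout.+- x y 1+yd₂≡xd₁ = split-by-Bézout x y 1+yd₂≡xd₁ N j
... | Bézout.-+ x y 1+xd₁≡yd₂ with split-by-Bézout y x 1+xd₁≡yd₂ N j
...   | j₂ , j₁ , d₂∣j₂ , d₁∣j₁ , j₂+j₁≡j = j₁ , j₂ , d₁∣j₁ , d₂∣j₂ , trans (cong (_% N) (+-comm j₁ j₂)) j₂+j₁≡j

-- N / g and u / g are coprime, so N / g divides u + 2 while g divides u; a common factor divides 2.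
odd-∣u[u+2]⇒coprime : ∀ {N u} .{{_ : NonZero (gcd u N)}} → ¬ 2 ∣ N → N ∣ u * (u + 2) →
                      Coprime (gcd u N) (N / gcd u N)
odd-∣u[u+2]⇒coprime {N} {u} 2∤N N∣u[u+2] {c} (c∣g , c∣N/g) with prime⇒irreducible prime[2] c∣2
  where
  g = gcd u N
  u[u+2]≡u/g*[u+2]*g : u * (u + 2) ≡ u / g * (u + 2) * g
  u[u+2]≡u/g*[u+2]*g = begin
    u * (u + 2)              ≡⟨ cong (_* (u + 2)) (m/n*n≡m (gcd[m,n]∣m u N)) ⟨
    u / g * g * (u + 2)      ≡⟨ rearrange (u / g) g (u + 2) ⟩
    u / g * (u + 2) * g      ∎
    where
    open ≡-Reasoning
    rearrange : ∀ x y z → x * y * z ≡ x * z * y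
    rearrange = solve-∀
  N/g∣u+2 : N / g ∣ u + 2
  N/g∣u+2 = coprime-divisor (Coprimality.sym (coprime-/gcd u N))
    (*-cancelʳ-∣ g (subst₂ _∣_ (sym (m/n*n≡m (gcd[m,n]∣n u N))) u[u+2]≡u/g*[u+2]*g N∣u[u+2]))
  c∣2 : c ∣ 2
  c∣2 = ∣m+n∣m⇒∣n (∣-trans c∣N/g N/g∣u+2) (∣-trans c∣g (gcd[m,n]∣m u N))
... | inj₁ c≡1 = c≡1
... | inj₂ refl = ⊥-elim (2∤N (∣-trans c∣N/g (m/n∣m (gcd[m,n]∣n u N))))

-- Counting with filterᵇ

private variable
  A B : Set

_×ᵇ_ : (A → Bool) → (B → Bool) → A × B → Bool
(p ×ᵇ q) (x , y) = p x ∧ q y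

length-filterᵇ-++ : ∀ (p : A → Bool) xs ys →
                    length (filterᵇ p (xs ++ ys)) ≡ length (filterᵇ p xs) + length (filterᵇ p ys)
length-filterᵇ-++ p xs ys = trans (cong length (filter-++ (T? ∘ p) xs ys)) (length-++ (filterᵇ p xs))

length-filterᵇ-map : ∀ (p : B → Bool) (f : A → B) xs →
                     length (filterᵇ p (map f xs)) ≡ length (filterᵇ (p ∘ f) xs)
length-filterᵇ-map p f []       = refl
length-filterᵇ-map p f (x ∷ xs) with p (f x)
... | true  = cong suc (length-filterᵇ-map p f xs)
... | false = length-filterᵇ-map p f xs

length-filterᵇ-row : ∀ (p : A → Bool) (q : B → Bool) x xs ys →
  length (filterᵇ (λ y → p x ∧ q y) ys) + length (filterᵇ p xs) * length (filterᵇ q ys)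
    ≡ length (filterᵇ p (x ∷ xs)) * length (filterᵇ q ys)
length-filterᵇ-row p q x xs ys with p x
... | true  = refl
... | false = cong (_+ length (filterᵇ p xs) * length (filterᵇ q ys)) (cong length (filter-none (T? ∘ λ _ → false) (universal (λ _ ()) ys)))

length-filterᵇ-cartesianProduct : ∀ (p : A → Bool) (q : B → Bool) xs ys →
  length (filterᵇ (p ×ᵇ q) (cartesianProduct xs ys)) ≡ length (filterᵇ p xs) * length (filterᵇ q ys)
length-filterᵇ-cartesianProduct p q []       ys = refl
length-filterᵇ-cartesianProduct p q (x ∷ xs) ys = begin
  length (filterᵇ (p ×ᵇ q) (map (x ,_) ys ++ cartesianProduct xs ys))
    ≡⟨ length-filterᵇ-++ (p ×ᵇ q) (map (x ,_) ys) (cartesianProduct xs ys) ⟩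
  length (filterᵇ (p ×ᵇ q) (map (x ,_) ys)) + length (filterᵇ (p ×ᵇ q) (cartesianProduct xs ys))
    ≡⟨ cong₂ _+_ (length-filterᵇ-map (p ×ᵇ q) (x ,_) ys) (length-filterᵇ-cartesianProduct p q xs ys) ⟩
  length (filterᵇ (λ y → p x ∧ q y) ys) + length (filterᵇ p xs) * length (filterᵇ q ys)
    ≡⟨ length-filterᵇ-row p q x xs ys ⟩
  length (filterᵇ p (x ∷ xs)) * length (filterᵇ q ys) ∎
  where open ≡-Reasoning

tabulate-∘toℕ : ∀ N (f : ℕ → A) → tabulate {n = N} (f ∘ toℕ) ≡ applyUpTo f N
tabulate-∘toℕ zero    f = refl
tabulate-∘toℕ (suc N) f = cong (f 0 ∷_) (tabulate-∘toℕ N (f ∘ suc))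

length-filterᵇ-allFin : ∀ (q : ℕ → Bool) N → length (filterᵇ (q ∘ toℕ) (allFin N)) ≡ length (filterᵇ q (upTo N))
length-filterᵇ-allFin q N = begin
  length (filterᵇ (q ∘ toℕ) (allFin N))   ≡⟨ length-filterᵇ-map q toℕ (allFin N) ⟨
  length (filterᵇ q (map toℕ (allFin N))) ≡⟨ cong (length ∘ filterᵇ q) (map-tabulate {n = N} id toℕ) ⟩
  length (filterᵇ q (tabulate {n = N} toℕ))     ≡⟨ cong (length ∘ filterᵇ q) (tabulate-∘toℕ N id) ⟩
  length (filterᵇ q (upTo N))             ∎
  where open ≡-Reasoning

applyUpTo-+ : ∀ (f : ℕ → A) k l → applyUpTo f (k + l) ≡ applyUpTo f k ++ applyUpTo (f ∘ (k +_)) l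
applyUpTo-+ f zero    l = refl
applyUpTo-+ f (suc k) l = cong (f 0 ∷_) (applyUpTo-+ (f ∘ suc) k l)

upTo-+ : ∀ k l → upTo (k + l) ≡ upTo k ++ map (k +_) (upTo l)
upTo-+ k l = trans (applyUpTo-+ id k l) (cong (upTo k ++_) (sym (map-upTo (k +_) l)))

infix 4 _∣ᵇ_
_∣ᵇ_ : ℕ → ℕ → Bool
d ∣ᵇ x = isYes (d ∣? x)

length-filterᵇ-multiples-window : ∀ d k → .{{NonZero d}} → d ∣ k → length (filterᵇ ((d ∣ᵇ_) ∘ (k +_)) (upTo d)) ≡ 1
length-filterᵇ-multiples-window (suc d′) k d∣k with suc d′ ∣? (k + 0)
... | no d∤k+0 = contradiction (subst (suc d′ ∣_) (sym (+-identityʳ k)) d∣k) d∤k+0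
... | yes _    = cong (suc ∘ length) (filter-none (T? ∘ (suc d′ ∣ᵇ_) ∘ (k +_)) (applyUpTo⁺₁ suc d′ d∤k+1+i))
  where
  d∤k+1+i : ∀ {i} → i < d′ → ¬ T (suc d′ ∣ᵇ k + suc i)
  d∤k+1+i {i} i<d′ d∣k+1+i = <⇒≱ (s<s i<d′) (∣⇒≤ (∣m+n∣m⇒∣n (toWitness d∣k+1+i) d∣k))

length-filterᵇ-multiples : ∀ d .{{_ : NonZero d}} t → length (filterᵇ (d ∣ᵇ_) (upTo (t * d))) ≡ t
length-filterᵇ-multiples d zero    = refl
length-filterᵇ-multiples d (suc t) = begin
  length (filterᵇ (d ∣ᵇ_) (upTo (d + t * d)))
    ≡⟨ cong (length ∘ filterᵇ (d ∣ᵇ_) ∘ upTo) (+-comm d (t * d)) ⟩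
  length (filterᵇ (d ∣ᵇ_) (upTo (t * d + d)))
    ≡⟨ cong (length ∘ filterᵇ (d ∣ᵇ_)) (upTo-+ (t * d) d) ⟩
  length (filterᵇ (d ∣ᵇ_) (upTo (t * d) ++ map (t * d +_) (upTo d)))
    ≡⟨ length-filterᵇ-++ (d ∣ᵇ_) (upTo (t * d)) _ ⟩
  length (filterᵇ (d ∣ᵇ_) (upTo (t * d))) + length (filterᵇ (d ∣ᵇ_) (map (t * d +_) (upTo d)))
    ≡⟨ cong₂ _+_ (length-filterᵇ-multiples d t)
                 (trans (length-filterᵇ-map (d ∣ᵇ_) (t * d +_) (upTo d))
                        (length-filterᵇ-multiples-window d (t * d) (n∣m*n t))) ⟩
  t + 1
    ≡⟨ +-comm t 1 ⟩
  suc t ∎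
  where open ≡-Reasoning

length-filterᵇ-multiples-allFin : ∀ d .{{_ : NonZero d}} t → length (filterᵇ ((d ∣ᵇ_) ∘ toℕ) (allFin (t * d))) ≡ t
length-filterᵇ-multiples-allFin d t = trans (length-filterᵇ-allFin (d ∣ᵇ_) (t * d)) (length-filterᵇ-multiples d t)

length-cartesianProduct : ∀ (xs : List A) (ys : List B) → length (cartesianProduct xs ys) ≡ length xs * length ys
length-cartesianProduct []       ys = refl
length-cartesianProduct (x ∷ xs) ys =
  trans (length-++ (map (x ,_) ys)) (cong₂ _+_ (length-map (x ,_) ys) (length-cartesianProduct xs ys))

-- The metacyclic group in normal form

module MetacyclicProperties (m n r : ℕ) .{{_ : NonZero m}} .{{_ : NonZero n}} (rⁿ≡1 : r ^ n ≡ 1 mod m) where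

  open Metacyclic m n r renaming (∣_∣ to card)

  infix 25 b^_a^_
  b^_a^_ : ℕ → ℕ → G
  b^ j a^ i = (fromℕ< (m%n<n j n) , fromℕ< (m%n<n i m))

  expᵇ expᵃ : G → ℕ
  expᵇ = toℕ ∘ proj₁
  expᵃ = toℕ ∘ proj₂

  normal-form : ∀ g → b^ expᵇ g a^ expᵃ g ≡ g
  normal-form (j , i) = cong₂ _,_ (fromℕ<-% j) (fromℕ<-% i)
    where
    fromℕ<-% : ∀ {d} .{{_ : NonZero d}} (k : Fin d) → fromℕ< (m%n<n (toℕ k) d) ≡ k
    fromℕ<-% {d} k = toℕ-injective (trans (toℕ-fromℕ< _) (m<n⇒m%n≡m (toℕ<n k)))

  expᵇ-b^a^ : ∀ j i → expᵇ (b^ j a^ i) ≡ j mod n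
  expᵇ-b^a^ j i = trans (cong (_% n) (toℕ-fromℕ< _)) (%-≡-mod j)

  expᵃ-b^a^ : ∀ j i → expᵃ (b^ j a^ i) ≡ i mod m
  expᵃ-b^a^ j i = trans (cong (_% m) (toℕ-fromℕ< _)) (%-≡-mod i)

  expᵇ-· : ∀ g h → expᵇ (g · h) ≡ (expᵇ g + expᵇ h) % n
  expᵇ-· g h = toℕ-fromℕ< _

  b^a^-cong : ∀ {j j′ i i′} → j ≡ j′ mod n → i ≡ i′ mod m → b^ j a^ i ≡ b^ j′ a^ i′
  b^a^-cong j≡j′ i≡i′ = cong₂ _,_ (fromℕ<-cong _ _ j≡j′ _ _) (fromℕ<-cong _ _ i≡i′ _ _)

  b^a^-injective : ∀ {j j′ i i′} → b^ j a^ i ≡ b^ j′ a^ i′ → j ≡ j′ mod n × i ≡ i′ mod m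
  b^a^-injective {j} {j′} {i} {i′} eq =
    trans (sym (expᵇ-b^a^ j i)) (trans (cong (λ g → expᵇ g % n) eq) (expᵇ-b^a^ j′ i′)) ,
    trans (sym (expᵃ-b^a^ j i)) (trans (cong (λ g → expᵃ g % m) eq) (expᵃ-b^a^ j′ i′))

  b^a^≡e : ∀ {j i} → n ∣ j → m ∣ i → b^ j a^ i ≡ e
  b^a^≡e n∣j m∣i = b^a^-cong (∣⇒≡0-mod n∣j) (∣⇒≡0-mod m∣i)

  r^%≡r^ : ∀ l → r ^ (l % n) ≡ r ^ l mod m
  r^%≡r^ = ^≡1⇒^%≡^ rⁿ≡1

  b^a^-· : ∀ j i l k → b^ j a^ i · b^ l a^ k ≡ b^ (j + l) a^ (i * r ^ l + k)
  b^a^-· j i l k = b^a^-cong (+-cong-mod (expᵇ-b^a^ j i) (expᵇ-b^a^ l k))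
                             (+-cong-mod (*-cong-mod (expᵃ-b^a^ j i) r^expᵇ≡r^l) (expᵃ-b^a^ l k))
    where
    r^expᵇ≡r^l : r ^ expᵇ (b^ l a^ k) ≡ r ^ l mod m
    r^expᵇ≡r^l = trans (cong (λ x → r ^ x % m) (toℕ-fromℕ< (m%n<n l n))) (r^%≡r^ l)

  ·-assoc : ∀ g h k → (g · h) · k ≡ g · (h · k)
  ·-assoc g h k rewrite sym (normal-form g) | sym (normal-form h) | sym (normal-form k) =
    b^a^-assoc (expᵇ g) (expᵃ g) (expᵇ h) (expᵃ h) (expᵇ k) (expᵃ k)
    where
    b^a^-assoc : ∀ j i l k p q → (b^ j a^ i · b^ l a^ k) · b^ p a^ q ≡ b^ j a^ i · (b^ l a^ k · b^ p a^ q)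
    b^a^-assoc j i l k p q = begin
      (b^ j a^ i · b^ l a^ k) · b^ p a^ q                  ≡⟨ cong (_· b^ p a^ q) (b^a^-· j i l k) ⟩
      b^ (j + l) a^ (i * r ^ l + k) · b^ p a^ q            ≡⟨ b^a^-· (j + l) _ p q ⟩
      b^ (j + l + p) a^ ((i * r ^ l + k) * r ^ p + q)      ≡⟨ cong₂ b^_a^_ (+-assoc j l p) (twist i k q (r ^ l) (r ^ p)) ⟩
      b^ (j + (l + p)) a^ (i * (r ^ l * r ^ p) + (k * r ^ p + q))
                                                            ≡⟨ cong (λ x → b^ (j + (l + p)) a^ (i * x + (k * r ^ p + q))) (^-distribˡ-+-* r l p) ⟨
      b^ (j + (l + p)) a^ (i * r ^ (l + p) + (k * r ^ p + q)) ≡⟨ b^a^-· j i (l + p) _ ⟨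
      b^ j a^ i · b^ (l + p) a^ (k * r ^ p + q)            ≡⟨ cong (b^ j a^ i ·_) (b^a^-· l k p q) ⟨
      b^ j a^ i · (b^ l a^ k · b^ p a^ q)                  ∎
      where
      open ≡-Reasoning
      twist : ∀ i k q x y → (i * x + k) * y + q ≡ i * (x * y) + (k * y + q)
      twist = solve-∀

  ·-identityˡ : ∀ g → e · g ≡ g
  ·-identityˡ g = trans (cong (e ·_) (sym (normal-form g))) (trans (b^a^-· 0 0 (expᵇ g) (expᵃ g)) (normal-form g))

  ·-identityʳ : ∀ g → g · e ≡ g
  ·-identityʳ g = begin
    g · e                                        ≡⟨ cong (_· e) (normal-form g) ⟨
    b^ expᵇ g a^ expᵃ g · b^ 0 a^ 0              ≡⟨ b^a^-· (expᵇ g) (expᵃ g) 0 0 ⟩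
    b^ (expᵇ g + 0) a^ (expᵃ g * 1 + 0)          ≡⟨ cong₂ b^_a^_ (+-identityʳ _) (trans (+-identityʳ _) (*-identityʳ _)) ⟩
    b^ expᵇ g a^ expᵃ g                          ≡⟨ normal-form g ⟩
    g                                            ∎
    where open ≡-Reasoning

  -- pred n and pred m act as −1: the product g · g ⁻¹ has exponents j n and x m.
  infix 10 _⁻¹
  _⁻¹ : G → G
  g ⁻¹ = b^ (expᵇ g * pred n) a^ (expᵃ g * r ^ (expᵇ g * pred n) * pred m)

  ·-inverseʳ : ∀ g → g · g ⁻¹ ≡ e
  ·-inverseʳ g = begin
    g · g ⁻¹                              ≡⟨ cong (_· g ⁻¹) (normal-form g) ⟨
    b^ j a^ i · g ⁻¹                      ≡⟨ b^a^-· j i (j * pred n) (x * pred m) ⟩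
    b^ (j + j * pred n) a^ (x + x * pred m) ≡⟨ b^a^≡e (divides j (k+k*pred[d]≡k*d n j)) (divides x (k+k*pred[d]≡k*d m x)) ⟩
    e                                     ∎
    where
    open ≡-Reasoning
    j = expᵇ g
    i = expᵃ g
    x = i * r ^ (j * pred n)
    k+k*pred[d]≡k*d : ∀ d .{{_ : NonZero d}} k → k + k * pred d ≡ k * d
    k+k*pred[d]≡k*d d k = trans (sym (*-suc k (pred d))) (cong (k *_) (suc-pred d))

  ^ᴳ-+ : ∀ g k l → g ^ᴳ (k + l) ≡ g ^ᴳ k · g ^ᴳ l
  ^ᴳ-+ g zero    l = sym (·-identityˡ (g ^ᴳ l))
  ^ᴳ-+ g (suc k) l = trans (cong (g ·_) (^ᴳ-+ g k l)) (sym (·-assoc g (g ^ᴳ k) (g ^ᴳ l)))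

  ^ᴳ-*-assoc : ∀ g k l → (g ^ᴳ k) ^ᴳ l ≡ g ^ᴳ (k * l)
  ^ᴳ-*-assoc g k zero    = cong (g ^ᴳ_) (sym (*-zeroʳ k))
  ^ᴳ-*-assoc g k (suc l) = begin
    g ^ᴳ k · (g ^ᴳ k) ^ᴳ l     ≡⟨ cong (g ^ᴳ k ·_) (^ᴳ-*-assoc g k l) ⟩
    g ^ᴳ k · g ^ᴳ (k * l)      ≡⟨ ^ᴳ-+ g k (k * l) ⟨
    g ^ᴳ (k + k * l)           ≡⟨ cong (g ^ᴳ_) (*-suc k l) ⟨
    g ^ᴳ (k * suc l)           ∎
    where open ≡-Reasoning

  expᵇ-^ᴳ : ∀ g k → expᵇ (g ^ᴳ k) ≡ (k * expᵇ g) % n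
  expᵇ-^ᴳ g zero    = toℕ-fromℕ< _
  expᵇ-^ᴳ g (suc k) = begin
    expᵇ (g · g ^ᴳ k)                  ≡⟨ expᵇ-· g (g ^ᴳ k) ⟩
    (expᵇ g + expᵇ (g ^ᴳ k)) % n       ≡⟨ cong (λ x → (expᵇ g + x) % n) (expᵇ-^ᴳ g k) ⟩
    (expᵇ g + (k * expᵇ g) % n) % n    ≡⟨ +-cong-mod {x = expᵇ g} refl (%-≡-mod (k * expᵇ g)) ⟩
    (expᵇ g + k * expᵇ g) % n          ∎
    where open ≡-Reasoning

  a^ᴳ≡b^0a^ : ∀ k → a ^ᴳ k ≡ b^ 0 a^ k
  a^ᴳ≡b^0a^ zero    = refl
  a^ᴳ≡b^0a^ (suc k) = trans (cong (a ·_) (a^ᴳ≡b^0a^ k)) (b^a^-· 0 1 0 k)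

  b^ᴳ≡b^a^0 : ∀ k → b ^ᴳ k ≡ b^ k a^ 0
  b^ᴳ≡b^a^0 zero    = refl
  b^ᴳ≡b^a^0 (suc k) = trans (cong (b ·_) (b^ᴳ≡b^a^0 k)) (b^a^-· 1 0 k 0)

  a·b≡b·a^r : a · b ≡ b · a ^ᴳ r
  a·b≡b·a^r = begin
    a · b                    ≡⟨ b^a^-· 0 1 1 0 ⟩
    b^ 1 a^ (1 * r ^ 1 + 0)  ≡⟨ cong b^ 1 a^_ (trans (+-identityʳ _) (trans (*-identityˡ _) (*-identityʳ r))) ⟩
    b^ 1 a^ r                ≡⟨ b^a^-· 1 0 0 r ⟨
    b · b^ 0 a^ r            ≡⟨ cong (b ·_) (a^ᴳ≡b^0a^ r) ⟨
    b · a ^ᴳ r               ∎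
    where open ≡-Reasoning

  r≢1⇒a≢e : ¬ r ≡ 1 mod m → a ≢ e
  r≢1⇒a≢e r≢1 a≡e = r≢1 (begin
    r % m           ≡⟨ cong (_% m) (*-identityʳ r) ⟨
    (r * 1) % m     ≡⟨ *-cong-mod {x = r} refl (proj₂ (b^a^-injective a≡e)) ⟩
    (r * 0) % m     ≡⟨ cong (_% m) (*-zeroʳ r) ⟩
    0 % m           ≡⟨ proj₂ (b^a^-injective a≡e) ⟨
    1 % m           ∎)
    where open ≡-Reasoning

  b-order : HasOrder b n
  b-order = >-nonZero⁻¹ n , trans (b^ᴳ≡b^a^0 n) (b^a^≡e ∣-refl (m ∣0)) , bʲ≢e
    where
    bʲ≢e : ∀ j → 1 ≤ j → j < n → b ^ᴳ j ≢ e
    bʲ≢e j 1≤j j<n bʲ≡e = <⇒≢ 1≤j (sym (≡-mod⇒≡ j<n (>-nonZero⁻¹ n) j≡0))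
      where
      j≡0 : j ≡ 0 mod n
      j≡0 = proj₁ (b^a^-injective (trans (sym (b^ᴳ≡b^a^0 j)) bʲ≡e))

  ∣G∣≡n*m : ∣G∣ ≡ n * m
  ∣G∣≡n*m = trans (length-cartesianProduct (allFin n) (allFin m))
                  (cong₂ _*_ (length-tabulate {n = n} id) (length-tabulate {n = m} id))

  -- For d₁ ∣ n and d₂ ∣ m this is the subgroup generated by b^d₁ and a^d₂.
  Box : ℕ → ℕ → Subset
  Box d₁ d₂ = ((d₁ ∣ᵇ_) ∘ toℕ) ×ᵇ ((d₂ ∣ᵇ_) ∘ toℕ)

  ∈-Box⁺ : ∀ {d₁ d₂ g} → d₁ ∣ expᵇ g → d₂ ∣ expᵃ g → g ∈ Box d₁ d₂
  ∈-Box⁺ {d₁} {d₂} {g} d₁∣j d₂∣i with d₁ ∣? expᵇ g | d₂ ∣? expᵃ g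
  ... | yes _   | yes _   = refl
  ... | no d₁∤j | _       = contradiction d₁∣j d₁∤j
  ... | yes _   | no d₂∤i = contradiction d₂∣i d₂∤i

  ∈-Box⁻ : ∀ {d₁ d₂} g → g ∈ Box d₁ d₂ → d₁ ∣ expᵇ g × d₂ ∣ expᵃ g
  ∈-Box⁻ {d₁} {d₂} g g∈Box with d₁ ∣? expᵇ g | d₂ ∣? expᵃ g
  ... | yes d₁∣j | yes d₂∣i = d₁∣j , d₂∣i

  b^a^∈Box : ∀ {d₁ d₂ j i} → d₁ ∣ n → d₂ ∣ m → d₁ ∣ j → d₂ ∣ i → b^ j a^ i ∈ Box d₁ d₂
  b^a^∈Box d₁∣n d₂∣m d₁∣j d₂∣i =
    ∈-Box⁺ (subst (_ ∣_) (sym (toℕ-fromℕ< _)) (%-presˡ-∣ d₁∣j d₁∣n))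
           (subst (_ ∣_) (sym (toℕ-fromℕ< _)) (%-presˡ-∣ d₂∣i d₂∣m))

  Box-subgroup : ∀ {d₁ d₂} → d₁ ∣ n → d₂ ∣ m → IsSubgroup (Box d₁ d₂)
  Box-subgroup {d₁} {d₂} d₁∣n d₂∣m = b^a^∈Box d₁∣n d₂∣m (d₁ ∣0) (d₂ ∣0) , ·-closed , ⁻¹-closed
    where
    ·-closed : ∀ g h → g ∈ Box d₁ d₂ → h ∈ Box d₁ d₂ → (g · h) ∈ Box d₁ d₂
    ·-closed g h g∈Box h∈Box with ∈-Box⁻ g g∈Box | ∈-Box⁻ h h∈Box
    ... | d₁∣j , d₂∣i | d₁∣l , d₂∣k =
      b^a^∈Box d₁∣n d₂∣m (∣m∣n⇒∣m+n d₁∣j d₁∣l) (∣m∣n⇒∣m+n (∣m⇒∣m*n _ d₂∣i) d₂∣k)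
    ⁻¹-closed : ∀ g → g ∈ Box d₁ d₂ → Σ G λ h → h ∈ Box d₁ d₂ × g · h ≡ e
    ⁻¹-closed g g∈Box with ∈-Box⁻ g g∈Box
    ... | d₁∣j , d₂∣i =
      g ⁻¹ , b^a^∈Box d₁∣n d₂∣m (∣m⇒∣m*n _ d₁∣j) (∣m⇒∣m*n _ (∣m⇒∣m*n _ d₂∣i)) , ·-inverseʳ g

  -- Box d 1 is the preimage of the subgroup dℤ/nℤ under the homomorphism expᵇ : G → ℤ/nℤ.
  Box-normal : ∀ {d} → d ∣ n → IsNormal (Box d 1)
  Box-normal {d} d∣n = Box-subgroup d∣n (1∣ m) , conj-closed
    where
    conj-closed : ∀ g g′ h → g · g′ ≡ e → h ∈ Box d 1 → (g · h · g′) ∈ Box d 1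
    conj-closed g g′ h gg′≡e h∈Box = ∈-Box⁺ (∣-resp-≡-mod d∣n expᵇ[ghg′]≡expᵇh (proj₁ (∈-Box⁻ h h∈Box))) (1∣ _)
      where
      x = expᵇ g ; y = expᵇ h ; x′ = expᵇ g′
      x+x′≡0 : x + x′ ≡ 0 mod n
      x+x′≡0 = trans (sym (expᵇ-· g g′)) (trans (cong expᵇ gg′≡e) (toℕ-fromℕ< _))
      expᵇ[ghg′]≡expᵇh : expᵇ (g · h · g′) ≡ y mod n
      expᵇ[ghg′]≡expᵇh = begin
        expᵇ (g · h · g′) % n            ≡⟨ cong (_% n) (expᵇ-· (g · h) g′) ⟩
        (expᵇ (g · h) + x′) % n % n      ≡⟨ %-≡-mod _ ⟩
        (expᵇ (g · h) + x′) % n          ≡⟨ cong (λ z → (z + x′) % n) (expᵇ-· g h) ⟩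
        ((x + y) % n + x′) % n           ≡⟨ +-cong-mod (%-≡-mod (x + y)) refl ⟩
        (x + y + x′) % n                 ≡⟨ cong (_% n) (rearrange x y x′) ⟩
        (y + (x + x′)) % n               ≡⟨ +-cong-mod {x = y} refl x+x′≡0 ⟩
        (y + 0) % n                      ≡⟨ cong (_% n) (+-identityʳ y) ⟩
        y % n                            ∎
        where
        open ≡-Reasoning
        rearrange : ∀ x y x′ → x + y + x′ ≡ y + (x + x′)
        rearrange = solve-∀

  card-Box : ∀ {d₁ d₂ t₁ t₂} .{{_ : NonZero d₁}} .{{_ : NonZero d₂}} →
             n ≡ t₁ * d₁ → m ≡ t₂ * d₂ → card (Box d₁ d₂) ≡ t₁ * t₂
  card-Box {d₁} {d₂} {t₁} {t₂} n≡t₁d₁ m≡t₂d₂ = begin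
    card (Box d₁ d₂)
      ≡⟨ length-filterᵇ-cartesianProduct ((d₁ ∣ᵇ_) ∘ toℕ) ((d₂ ∣ᵇ_) ∘ toℕ) (allFin n) (allFin m) ⟩
    length (filterᵇ ((d₁ ∣ᵇ_) ∘ toℕ) (allFin n)) * length (filterᵇ ((d₂ ∣ᵇ_) ∘ toℕ) (allFin m))
      ≡⟨ cong₂ _*_ (count-multiples d₁ t₁ n≡t₁d₁) (count-multiples d₂ t₂ m≡t₂d₂) ⟩
    t₁ * t₂ ∎
    where
    open ≡-Reasoning
    count-multiples : ∀ d .{{_ : NonZero d}} t {N} → N ≡ t * d → length (filterᵇ ((d ∣ᵇ_) ∘ toℕ) (allFin N)) ≡ t
    count-multiples d t refl = length-filterᵇ-multiples-allFin d t

  -- Sylow subgroups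

  Box-sylow : ∀ {p n′ m′} β α → Prime p →
              n ≡ p ^ β * n′ → m ≡ p ^ α * m′ → ¬ p ∣ n′ → ¬ p ∣ m′ → IsSylow p (Box n′ m′)
  Box-sylow {p} {n′} {m′} β α p-prime n≡ m≡ p∤n′ p∤m′ =
    Box-subgroup (divides (p ^ β) n≡) (divides (p ^ α) m≡) , β + α , card≡pᵏ ,
    divides (n′ * m′) (trans ∣G∣≡pᵏn′m′ (*-comm (p ^ (β + α)) _)) , pᵏ⁺¹∤∣G∣
    where
    instance
      p≢0 = prime⇒nonZero p-prime
      n′≢0 = nonZero-factorʳ (p ^ β) n≡
      m′≢0 = nonZero-factorʳ (p ^ α) m≡
    card≡pᵏ : card (Box n′ m′) ≡ p ^ (β + α)
    card≡pᵏ = trans (card-Box {t₁ = p ^ β} {t₂ = p ^ α} n≡ m≡) (sym (^-distribˡ-+-* p β α))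
    ∣G∣≡pᵏn′m′ : ∣G∣ ≡ p ^ (β + α) * (n′ * m′)
    ∣G∣≡pᵏn′m′ = begin
      ∣G∣                             ≡⟨ ∣G∣≡n*m ⟩
      n * m                           ≡⟨ cong₂ _*_ n≡ m≡ ⟩
      p ^ β * n′ * (p ^ α * m′)       ≡⟨ interchange (p ^ β) n′ (p ^ α) m′ ⟩
      p ^ β * p ^ α * (n′ * m′)       ≡⟨ cong (_* (n′ * m′)) (^-distribˡ-+-* p β α) ⟨
      p ^ (β + α) * (n′ * m′)         ∎
      where
      open ≡-Reasoning
      interchange : ∀ w x y z → w * x * (y * z) ≡ w * y * (x * z)
      interchange = solve-∀
    pᵏ⁺¹∤∣G∣ : ¬ p ^ suc (β + α) ∣ ∣G∣
    pᵏ⁺¹∤∣G∣ pᵏ⁺¹∣∣G∣ with euclidsLemma n′ m′ p-prime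
      (*-cancelˡ-∣ (p ^ (β + α)) {{m^n≢0 p (β + α)}}
        (subst₂ _∣_ (*-comm p (p ^ (β + α))) ∣G∣≡pᵏn′m′ pᵏ⁺¹∣∣G∣))
    ... | inj₁ p∣n′ = p∤n′ p∣n′
    ... | inj₂ p∣m′ = p∤m′ p∣m′

  -- If g generated the box, a^c (with c = m / p) and b^n′ would be powers g^u and g^v; comparing
  -- (b^n′)^u = (a^c)^v forces p ∣ v, and then the b-exponent n′ of g^v would be divisible by p n′.
  Box-noncyclic : ∀ {p n′ m′} β α → Prime p → n ≡ p ^ suc β * n′ → m ≡ p ^ suc α * m′ →
                  ¬ IsCyclic (Box n′ m′)
  Box-noncyclic {p} {n′} {m′} β α p-prime n≡ m≡ (g , g∈Box , generates) =
    powers-of-g (generates (a ^ᴳ c) aᶜ∈Box) (generates (b ^ᴳ n′) bⁿ′∈Box)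
    where
    c = p ^ α * m′
    instance
      n′≢0 = nonZero-factorʳ (p ^ suc β) n≡
      c≢0 = nonZero-factorʳ p (trans m≡ (*-assoc p (p ^ α) m′))
    m≡pc : m ≡ p * c
    m≡pc = trans m≡ (*-assoc p (p ^ α) m′)
    pn′∣n : p * n′ ∣ n
    pn′∣n = divides (p ^ β) (trans n≡ (rearrange p (p ^ β) n′))
      where
      rearrange : ∀ x y z → x * y * z ≡ y * (x * z)
      rearrange = solve-∀
    n′∣n : n′ ∣ n
    n′∣n = m*n∣⇒n∣ p n′ pn′∣n
    m′∣m : m′ ∣ m
    m′∣m = divides (p ^ suc α) m≡
    aᶜ∈Box : (a ^ᴳ c) ∈ Box n′ m′
    aᶜ∈Box = subst (_∈ Box n′ m′) (sym (a^ᴳ≡b^0a^ c)) (b^a^∈Box n′∣n m′∣m (n′ ∣0) (n∣m*n (p ^ α)))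
    bⁿ′∈Box : (b ^ᴳ n′) ∈ Box n′ m′
    bⁿ′∈Box = subst (_∈ Box n′ m′) (sym (b^ᴳ≡b^a^0 n′)) (b^a^∈Box n′∣n m′∣m ∣-refl (m′ ∣0))

    powers-of-g : (Σ ℕ λ u → a ^ᴳ c ≡ g ^ᴳ u) → (Σ ℕ λ v → b ^ᴳ n′ ≡ g ^ᴳ v) → ⊥
    powers-of-g (u , aᶜ≡gᵘ) (v , bⁿ′≡gᵛ) = ¬prime[1] (subst Prime (∣1⇒≡1 p∣1) p-prime)
      where
      open ≡-Reasoning
      b^n′u≡a^cv : b^ (n′ * u) a^ 0 ≡ b^ 0 a^ (c * v)
      b^n′u≡a^cv = begin
        b^ (n′ * u) a^ 0     ≡⟨ b^ᴳ≡b^a^0 (n′ * u) ⟨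
        b ^ᴳ (n′ * u)        ≡⟨ ^ᴳ-*-assoc b n′ u ⟨
        (b ^ᴳ n′) ^ᴳ u       ≡⟨ cong (_^ᴳ u) bⁿ′≡gᵛ ⟩
        (g ^ᴳ v) ^ᴳ u        ≡⟨ ^ᴳ-*-assoc g v u ⟩
        g ^ᴳ (v * u)         ≡⟨ cong (g ^ᴳ_) (*-comm v u) ⟩
        g ^ᴳ (u * v)         ≡⟨ ^ᴳ-*-assoc g u v ⟨
        (g ^ᴳ u) ^ᴳ v        ≡⟨ cong (_^ᴳ v) aᶜ≡gᵘ ⟨
        (a ^ᴳ c) ^ᴳ v        ≡⟨ ^ᴳ-*-assoc a c v ⟩
        a ^ᴳ (c * v)         ≡⟨ a^ᴳ≡b^0a^ (c * v) ⟩
        b^ 0 a^ (c * v)      ∎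
      p∣v : p ∣ v
      p∣v = *-cancelʳ-∣ c (subst₂ _∣_ m≡pc (*-comm c v) (≡0-mod⇒∣ (sym (proj₂ (b^a^-injective b^n′u≡a^cv)))))
      n′≡v*expᵇg : n′ ≡ v * expᵇ g mod n
      n′≡v*expᵇg = begin
        n′ % n                    ≡⟨ expᵇ-b^a^ n′ 0 ⟨
        expᵇ (b^ n′ a^ 0) % n     ≡⟨ cong (λ h → expᵇ h % n) (trans (sym (b^ᴳ≡b^a^0 n′)) bⁿ′≡gᵛ) ⟩
        expᵇ (g ^ᴳ v) % n         ≡⟨ cong (_% n) (expᵇ-^ᴳ g v) ⟩
        (v * expᵇ g) % n % n      ≡⟨ %-≡-mod _ ⟩
        (v * expᵇ g) % n          ∎
      pn′∣n′ : p * n′ ∣ 1 * n′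
      pn′∣n′ = subst (p * n′ ∣_) (sym (*-identityˡ n′))
        (∣-resp-≡-mod pn′∣n n′≡v*expᵇg (*-pres-∣ p∣v (proj₁ (∈-Box⁻ g g∈Box))))
      p∣1 : p ∣ 1
      p∣1 = *-cancelʳ-∣ n′ pn′∣n′

  sylow-cyclic⇒coprime : AllSylowCyclic → Coprime n m
  sylow-cyclic⇒coprime all-cyclic with coprime? n m
  ... | yes n⊥m = n⊥m
  ... | no ¬n⊥m with ¬coprime⇒common-prime-divisor (≢-nonZero⁻¹ n) ¬n⊥m
  ...   | p , p-prime , p∣n , p∣m with prime-power-split p-prime p∣n | prime-power-split p-prime p∣m
  ...     | β , n′ , n≡pᵝn′ , p∤n′ | α , m′ , m≡pᵅm′ , p∤m′ =
    ⊥-elim (Box-noncyclic β α p-prime n≡pᵝn′ m≡pᵅm′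
              (all-cyclic p (Box n′ m′) p-prime (Box-sylow (suc β) (suc α) p-prime n≡pᵝn′ m≡pᵅm′ p∤n′ p∤m′)))

  -- Direct decompositions

  module _ {d₁ d₂} .{{_ : NonZero d₁}} (n≡d₁d₂ : n ≡ d₁ * d₂) (d₁⊥d₂ : Coprime d₁ d₂)
           (d₁<n : d₁ < n) (r^d₁≡1 : r ^ d₁ ≡ 1 mod m) (a≢e : a ≢ e) where

    private
      d₁∣n : d₁ ∣ n
      d₁∣n = divides d₂ (trans n≡d₁d₂ (*-comm d₁ d₂))
      d₂∣n : d₂ ∣ n
      d₂∣n = divides d₁ n≡d₁d₂

    Box-central : ∀ g h → h ∈ Box d₁ m → g · h ≡ h · g
    Box-central g h h∈Box = b^a^-cong (cong (_% n) (+-comm (expᵇ g) (expᵇ h))) (begin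
      (i * r ^ expᵇ h + k) % m      ≡⟨ +-cong-mod (*-cong-mod {x = i} refl r^l≡1) k≡0 ⟩
      (i * 1 + 0) % m               ≡⟨ cong (_% m) (trans (+-identityʳ _) (*-identityʳ i)) ⟩
      (0 * r ^ expᵇ g + i) % m      ≡⟨ +-cong-mod (*-cong-mod k≡0 refl) refl ⟨
      (k * r ^ expᵇ g + i) % m      ∎)
      where
      open ≡-Reasoning
      i = expᵃ g ; k = expᵃ h
      r^l≡1 : r ^ expᵇ h ≡ 1 mod m
      r^l≡1 = ^≡1⇒∣⇒^≡1 r^d₁≡1 (proj₁ (∈-Box⁻ {d₁} {m} h h∈Box))
      k≡0 : k ≡ 0 mod m
      k≡0 = ∣⇒≡0-mod (proj₂ (∈-Box⁻ {d₁} {m} h h∈Box))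

    Box-central-normal : IsNormal (Box d₁ m)
    Box-central-normal = Box-subgroup d₁∣n ∣-refl , λ g g′ h gg′≡e h∈Box →
      subst (_∈ Box d₁ m) (sym (begin
        g · h · g′      ≡⟨ cong (_· g′) (Box-central g h h∈Box) ⟩
        h · g · g′      ≡⟨ ·-assoc h g g′ ⟩
        h · (g · g′)    ≡⟨ cong (h ·_) gg′≡e ⟩
        h · e           ≡⟨ ·-identityʳ h ⟩
        h               ∎)) h∈Box
      where open ≡-Reasoning

    Box-disjoint : ∀ x → x ∈ Box d₁ m → x ∈ Box d₂ 1 → x ≡ e
    Box-disjoint x x∈H x∈K = trans (sym (normal-form x)) (b^a^≡e n∣j m∣i)
      where
      m∣i = proj₂ (∈-Box⁻ x x∈H)
      n∣j = subst (_∣ expᵇ x) (sym n≡d₁d₂) (coprime⇒*∣ d₁⊥d₂ (proj₁ (∈-Box⁻ x x∈H)) (proj₁ (∈-Box⁻ x x∈K)))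

    Box-product : ∀ g → Σ G λ h → Σ G λ k → h ∈ Box d₁ m × k ∈ Box d₂ 1 × g ≡ h · k
    Box-product g with coprime⇒split d₁⊥d₂ n (expᵇ g)
    ... | j₁ , j₂ , d₁∣j₁ , d₂∣j₂ , j₁+j₂≡j =
      b^ j₁ a^ 0 , b^ j₂ a^ expᵃ g ,
      b^a^∈Box d₁∣n ∣-refl d₁∣j₁ (m ∣0) , b^a^∈Box d₂∣n (1∣ m) d₂∣j₂ (1∣ _) ,
      (begin
        g                                  ≡⟨ normal-form g ⟨
        b^ expᵇ g a^ expᵃ g                ≡⟨ b^a^-cong (sym j₁+j₂≡j) refl ⟩
        b^ (j₁ + j₂) a^ (0 * r ^ j₂ + expᵃ g) ≡⟨ b^a^-· j₁ 0 j₂ (expᵃ g) ⟨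
        b^ j₁ a^ 0 · b^ j₂ a^ expᵃ g       ∎)
      where open ≡-Reasoning

    coprime-factorisation⇒direct-product :
      Σ Subset λ H → Σ Subset λ K → Nontrivial H × Nontrivial K × IsDirectProduct H K
    coprime-factorisation⇒direct-product =
      Box d₁ m , Box d₂ 1 ,
      (b^ d₁ a^ 0 , b^a^∈Box d₁∣n ∣-refl ∣-refl (m ∣0) , b^d₁≢e) ,
      (a , b^a^∈Box d₂∣n (1∣ m) (d₂ ∣0) (1∣ 1) , a≢e) ,
      Box-central-normal , Box-normal d₂∣n , Box-disjoint , Box-product
      where
      b^d₁≢e : b^ d₁ a^ 0 ≢ e
      b^d₁≢e b^d₁≡e = ≢-nonZero⁻¹ d₁ (≡-mod⇒≡ d₁<n (>-nonZero⁻¹ n) (proj₁ (b^a^-injective b^d₁≡e)))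

  t²≡1∧rᵗ≡r⇒t≡1 : ¬ r ≡ 1 mod m → ¬ 2 ∣ n → Indecomposable →
                  ∀ {t} → t < n → t * t ≡ 1 mod n → r ^ t ≡ r mod m → t ≡ 1
  t²≡1∧rᵗ≡r⇒t≡1 r≢1 _ _ {zero} _ _ r⁰≡r = ⊥-elim (r≢1 (sym r⁰≡r))
  t²≡1∧rᵗ≡r⇒t≡1 _ _ _ {suc zero} _ _ _ = refl
  t²≡1∧rᵗ≡r⇒t≡1 r≢1 2∤n indecomposable {suc (suc u′)} t<n t²≡1 rᵗ≡r =
    ⊥-elim (indecomposable (coprime-factorisation⇒direct-product n≡d₁d₂ d₁⊥d₂ d₁<n r^d₁≡1 (r≢1⇒a≢e r≢1)))
    where
    u = suc u′
    d₁ = gcd u n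
    instance d₁≢0 = ≢-nonZero (gcd[m,n]≢0 u n (inj₂ (≢-nonZero⁻¹ n)))
    n∣u[u+2] : n ∣ u * (u + 2)
    n∣u[u+2] = ≡0-mod⇒∣ (+-cancelʳ-mod 1 (trans (cong (_% n) (sym (square u))) t²≡1))
      where
      square : ∀ u → suc u * suc u ≡ u * (u + 2) + 1
      square = solve-∀
    n≡d₁d₂ : n ≡ d₁ * (n / d₁)
    n≡d₁d₂ = sym (m*[n/m]≡n (gcd[m,n]∣n u n))
    d₁⊥d₂ : Coprime d₁ (n / d₁)
    d₁⊥d₂ = odd-∣u[u+2]⇒coprime 2∤n n∣u[u+2]
    d₁<n : d₁ < n
    d₁<n = ≤-<-trans (∣⇒≤ (gcd[m,n]∣m u n)) (<-trans (n<1+n u) t<n)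
    r^d₁≡1 : r ^ d₁ ≡ 1 mod m
    r^d₁≡1 = ^≡1⇒^gcd≡1 {u = u} {v = n} (^suc≡⇒^≡1 {x = r} {n = n} {u = u} rⁿ≡1 rᵗ≡r) rⁿ≡1

  -- a^i b = b a^(i r), and i = c r^(n-1) makes i r ≡ c.
  expᵇ≡1⇒≡a^·b : ∀ g → expᵇ g ≡ 1 → g ≡ a ^ᴳ (expᵃ g * r ^ pred n) · b
  expᵇ≡1⇒≡a^·b g j≡1 = begin
    g                                               ≡⟨ normal-form g ⟨
    b^ expᵇ g a^ c                                  ≡⟨ b^a^-cong (cong (_% n) j≡1) (sym c*r^[n-1]*r≡c) ⟩
    b^ 1 a^ (c * r ^ pred n * r ^ 1 + 0)            ≡⟨ b^a^-· 0 (c * r ^ pred n) 1 0 ⟨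
    b^ 0 a^ (c * r ^ pred n) · b                    ≡⟨ cong (_· b) (a^ᴳ≡b^0a^ (c * r ^ pred n)) ⟨
    a ^ᴳ (c * r ^ pred n) · b                       ∎
    where
    open ≡-Reasoning
    c = expᵃ g
    c*r^[n-1]*r≡c : c * r ^ pred n * r ^ 1 + 0 ≡ c mod m
    c*r^[n-1]*r≡c = begin
      (c * r ^ pred n * r ^ 1 + 0) % m   ≡⟨ cong (_% m) (regroup c (r ^ pred n) r) ⟩
      (c * r ^ suc (pred n)) % m         ≡⟨ cong (λ k → (c * r ^ k) % m) (suc-pred n) ⟩
      (c * r ^ n) % m                    ≡⟨ *-cong-mod {x = c} refl rⁿ≡1 ⟩
      (c * 1) % m                        ≡⟨ cong (_% m) (*-identityʳ c) ⟩
      c % m                              ∎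
      where
      regroup : ∀ c x r → c * x * (r * 1) + 0 ≡ c * (r * x)
      regroup = solve-∀

  -- Automorphisms

  module _ {σ : G → G} (σ-aut : IsAutomorphism σ) where

    private
      σ-· : ∀ x y → σ (x · y) ≡ σ x · σ y
      σ-· = proj₁ σ-aut
      τ : G → G
      τ = proj₁ (proj₂ σ-aut)
      τσ≡id : ∀ x → τ (σ x) ≡ x
      τσ≡id = proj₁ (proj₂ (proj₂ σ-aut))
      στ≡id : ∀ x → σ (τ x) ≡ x
      στ≡id = proj₂ (proj₂ (proj₂ σ-aut))

    σ-e : σ e ≡ e
    σ-e = begin
      σ e                 ≡⟨ ·-identityʳ (σ e) ⟨
      σ e · e             ≡⟨ cong (σ e ·_) (στ≡id e) ⟨
      σ e · σ (τ e)       ≡⟨ σ-· e (τ e) ⟨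
      σ (e · τ e)         ≡⟨ cong σ (·-identityˡ (τ e)) ⟩
      σ (τ e)             ≡⟨ στ≡id e ⟩
      e                   ∎
      where open ≡-Reasoning

    σ-^ᴳ : ∀ g k → σ (g ^ᴳ k) ≡ σ g ^ᴳ k
    σ-^ᴳ g zero    = σ-e
    σ-^ᴳ g (suc k) = trans (σ-· g (g ^ᴳ k)) (cong (σ g ·_) (σ-^ᴳ g k))

    σ-injective : ∀ {x y} → σ x ≡ σ y → x ≡ y
    σ-injective {x} {y} σx≡σy = trans (sym (τσ≡id x)) (trans (cong τ σx≡σy) (τσ≡id y))

    σ-preserves-order : ∀ {g k} → HasOrder g k → HasOrder (σ g) k
    σ-preserves-order {g} {k} (1≤k , gᵏ≡e , gʲ≢e) =
      1≤k , trans (sym (σ-^ᴳ g k)) (trans (cong σ gᵏ≡e) σ-e) ,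
      λ j 1≤j j<k σgʲ≡e → gʲ≢e j 1≤j j<k (σ-injective (trans (σ-^ᴳ g j) (trans σgʲ≡e (sym σ-e))))

    -- σ a has order m, so its b-exponent x satisfies m x ≡ 0 mod n; coprimality forces x ≡ 0.
    σa≡a^ : Coprime n m → σ a ≡ a ^ᴳ expᵃ (σ a)
    σa≡a^ n⊥m = begin
      σ a                          ≡⟨ normal-form (σ a) ⟨
      b^ expᵇ (σ a) a^ expᵃ (σ a)  ≡⟨ b^a^-cong (∣⇒≡0-mod n∣x) refl ⟩
      b^ 0 a^ expᵃ (σ a)           ≡⟨ a^ᴳ≡b^0a^ (expᵃ (σ a)) ⟨
      a ^ᴳ expᵃ (σ a)              ∎
      where
      open ≡-Reasoning
      σaᵐ≡e : σ a ^ᴳ m ≡ e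
      σaᵐ≡e = trans (sym (σ-^ᴳ a m)) (trans (cong σ (trans (a^ᴳ≡b^0a^ m) (b^a^≡e (n ∣0) ∣-refl))) σ-e)
      n∣x : n ∣ expᵇ (σ a)
      n∣x = coprime-divisor n⊥m (≡0-mod⇒∣ (trans (sym (expᵇ-^ᴳ (σ a) m)) (trans (cong expᵇ σaᵐ≡e) (toℕ-fromℕ< _))))

    module _ (σ²≡id : ∀ x → σ (σ x) ≡ x) {s} (σa≡aˢ : σ a ≡ a ^ᴳ s) where

      private
        t = expᵇ (σ b)
        c = expᵃ (σ b)

      s²≡1 : s * s ≡ 1 mod m
      s²≡1 = sym (proj₂ (b^a^-injective (begin
        b^ 0 a^ 1           ≡⟨ σ²≡id a ⟨
        σ (σ a)             ≡⟨ cong σ σa≡aˢ ⟩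
        σ (a ^ᴳ s)          ≡⟨ σ-^ᴳ a s ⟩
        σ a ^ᴳ s            ≡⟨ cong (_^ᴳ s) σa≡aˢ ⟩
        (a ^ᴳ s) ^ᴳ s       ≡⟨ ^ᴳ-*-assoc a s s ⟩
        a ^ᴳ (s * s)        ≡⟨ a^ᴳ≡b^0a^ (s * s) ⟩
        b^ 0 a^ (s * s)     ∎)))
        where open ≡-Reasoning

      -- Apply σ to the relation a b = b a^r and compare a-exponents.
      rᵗ≡r : r ^ t ≡ r mod m
      rᵗ≡r = *-cancelˡ-mod {s = s} s²≡1 (+-cancelʳ-mod c s*rᵗ+c≡s*r+c)
        where
        open ≡-Reasoning
        s*rᵗ+c≡c+s*r : s * r ^ t + c ≡ c * r ^ 0 + s * r mod m
        s*rᵗ+c≡c+s*r = proj₂ (b^a^-injective (begin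
          b^ (0 + t) a^ (s * r ^ t + c)     ≡⟨ b^a^-· 0 s t c ⟨
          b^ 0 a^ s · b^ t a^ c             ≡⟨ cong₂ _·_ (trans (sym (a^ᴳ≡b^0a^ s)) (sym σa≡aˢ)) (normal-form (σ b)) ⟩
          σ a · σ b                         ≡⟨ σ-· a b ⟨
          σ (a · b)                         ≡⟨ cong σ a·b≡b·a^r ⟩
          σ (b · a ^ᴳ r)                    ≡⟨ σ-· b (a ^ᴳ r) ⟩
          σ b · σ (a ^ᴳ r)                  ≡⟨ cong (σ b ·_) (σ-^ᴳ a r) ⟩
          σ b · σ a ^ᴳ r                    ≡⟨ cong (λ x → σ b · x ^ᴳ r) σa≡aˢ ⟩
          σ b · (a ^ᴳ s) ^ᴳ r               ≡⟨ cong₂ _·_ (normal-form (σ b)) (sym (trans (^ᴳ-*-assoc a s r) (a^ᴳ≡b^0a^ (s * r)))) ⟨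
          b^ t a^ c · b^ 0 a^ (s * r)       ≡⟨ b^a^-· t c 0 (s * r) ⟩
          b^ (t + 0) a^ (c * r ^ 0 + s * r) ∎))
        s*rᵗ+c≡s*r+c : s * r ^ t + c ≡ s * r + c mod m
        s*rᵗ+c≡s*r+c = trans s*rᵗ+c≡c+s*r (cong (_% m) (trans (cong (_+ s * r) (*-identityʳ c)) (+-comm c (s * r))))

      -- Apply σ to σ b = b^t a^c and compare b-exponents.
      t²≡1 : t * t ≡ 1 mod n
      t²≡1 = begin
        (t * t) % n                               ≡⟨ cong (_% n) (+-identityʳ (t * t)) ⟨
        (t * t + 0) % n                           ≡⟨ +-cong-mod (trans (sym (%-≡-mod (t * t))) (cong (_% n) (sym (expᵇ-^ᴳ (σ b) t))))
                                                                 (sym (trans (cong (λ g → expᵇ g % n) (a^ᴳ≡b^0a^ (s * c))) (expᵇ-b^a^ 0 (s * c)))) ⟩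
        (expᵇ (σ b ^ᴳ t) + expᵇ (a ^ᴳ (s * c))) % n ≡⟨ %-≡-mod _ ⟨
        (expᵇ (σ b ^ᴳ t) + expᵇ (a ^ᴳ (s * c))) % n % n ≡⟨ cong (_% n) (expᵇ-· (σ b ^ᴳ t) (a ^ᴳ (s * c))) ⟨
        expᵇ (σ b ^ᴳ t · a ^ᴳ (s * c)) % n        ≡⟨ cong (λ g → expᵇ g % n) σσb≡σbᵗaˢᶜ ⟨
        expᵇ (σ (σ b)) % n                        ≡⟨ cong (λ g → expᵇ g % n) (σ²≡id b) ⟩
        expᵇ b % n                                ≡⟨ expᵇ-b^a^ 1 0 ⟩
        1 % n                                     ∎
        where
        open ≡-Reasoning
        σb≡bᵗaᶜ : σ b ≡ b ^ᴳ t · a ^ᴳ c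
        σb≡bᵗaᶜ = begin
          σ b                            ≡⟨ normal-form (σ b) ⟨
          b^ t a^ c                      ≡⟨ cong (λ j → b^ j a^ c) (+-identityʳ t) ⟨
          b^ (t + 0) a^ (0 * r ^ 0 + c)  ≡⟨ b^a^-· t 0 0 c ⟨
          b^ t a^ 0 · b^ 0 a^ c          ≡⟨ cong₂ _·_ (b^ᴳ≡b^a^0 t) (a^ᴳ≡b^0a^ c) ⟨
          b ^ᴳ t · a ^ᴳ c                ∎
        σσb≡σbᵗaˢᶜ : σ (σ b) ≡ σ b ^ᴳ t · a ^ᴳ (s * c)
        σσb≡σbᵗaˢᶜ = begin
          σ (σ b)                        ≡⟨ cong σ σb≡bᵗaᶜ ⟩
          σ (b ^ᴳ t · a ^ᴳ c)            ≡⟨ σ-· (b ^ᴳ t) (a ^ᴳ c) ⟩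
          σ (b ^ᴳ t) · σ (a ^ᴳ c)        ≡⟨ cong₂ _·_ (σ-^ᴳ b t) (σ-^ᴳ a c) ⟩
          σ b ^ᴳ t · σ a ^ᴳ c            ≡⟨ cong (λ x → σ b ^ᴳ t · x ^ᴳ c) σa≡aˢ ⟩
          σ b ^ᴳ t · (a ^ᴳ s) ^ᴳ c       ≡⟨ cong (σ b ^ᴳ t ·_) (^ᴳ-*-assoc a s c) ⟩
          σ b ^ᴳ t · a ^ᴳ (s * c)        ∎

lemma4p3 : (m n r : ℕ) .{{_ : NonZero m}} .{{_ : NonZero n}} →
    let open Metacyclic m n r in
    ¬ (r % m ≡ 1 % m) → (r ^ n) % m ≡ 1 % m →
    ¬ (2 ∣ ∣G∣) → AllSylowCyclic → Indecomposable →
    (σ : G → G) → IsAutomorphism σ → HasOrder2 σ →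
    Σ ℕ λ i → Σ ℕ λ s →
      σ b ≡ (a ^ᴳ i) · b × HasOrder ((a ^ᴳ i) · b) n
      × σ a ≡ a ^ᴳ s × (s * s) % m ≡ 1 % m
-- The conclusion holds for every involution σ.
lemma4p3 m n r r≢1 rⁿ≡1 2∤∣G∣ all-sylow-cyclic indecomposable σ σ-aut (σ²≡id , _) =
  i , s , σb≡aⁱb , subst (λ g → HasOrder g n) σb≡aⁱb (σ-preserves-order σ-aut b-order) ,
  σa≡aˢ , s²≡1 σ-aut σ²≡id σa≡aˢ
  where
  open Metacyclic m n r
  open MetacyclicProperties m n r rⁿ≡1
  s = expᵃ (σ a)
  i = expᵃ (σ b) * r ^ pred n
  σa≡aˢ : σ a ≡ a ^ᴳ s
  σa≡aˢ = σa≡a^ σ-aut (sylow-cyclic⇒coprime all-sylow-cyclic)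
  2∤n : ¬ 2 ∣ n
  2∤n 2∣n = 2∤∣G∣ (subst (2 ∣_) (sym ∣G∣≡n*m) (∣m⇒∣m*n m 2∣n))
  t≡1 : expᵇ (σ b) ≡ 1
  t≡1 = t²≡1∧rᵗ≡r⇒t≡1 r≢1 2∤n indecomposable (toℕ<n (proj₁ (σ b))) (t²≡1 σ-aut σ²≡id σa≡aˢ) (rᵗ≡r σ-aut σ²≡id σa≡aˢ)
  σb≡aⁱb : σ b ≡ a ^ᴳ i · b
  σb≡aⁱb = expᵇ≡1⇒≡a^·b (σ b) t≡1
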